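{- Let $G$ be a graph with at most two odd cycles. Then \[ 2\alpha(G)\le|\mathrm{core}(G)|+|\mathrm{corona}(G)|\le2\alpha(G)+2. \]
   Context: All graphs are finite, simple and undirected; an odd cycle is a cycle (subgraph) with an odd number of edges. $\alpha(G)$ is the maximum size of an independent set of $G$; $\Omega(G)$ is the family of maximum independent sets; $\mathrm{core}(G)=\bigcap_{S\in\Omega(G)}S$ and $\mathrm{corona}(G)=\bigcup_{S\in\Omega(G)}S$. -}

module Defs where

open import Data.Nat using (ℕ; _≤_; _+_; _*_)
open import Data.Bool using (Bool; true; false)
open import Data.Fin using (Fin)
open import Data.Fin.Subset using (Subset; _∈_; ∣_∣)
open import Data.List using (List; []; _∷_; _++_; [_]; zip; length)
open import Data.List.Membership.Propositional renaming (_∈_ to _∈ₗ_)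
open import Data.List.Relation.Unary.All using (All)
open import Data.List.Relation.Unary.Unique.Propositional using (Unique)
open import Data.Product using (_×_; _,_; Σ; ∃)
open import Data.Sum using (_⊎_)
open import Relation.Binary.PropositionalEquality using (_≡_)
open import Function.Bundles using (_⇔_)

record Graph (n : ℕ) : Set where
  field
    adj     : Fin n → Fin n → Bool
    symm    : ∀ i j → adj i j ≡ adj j i
    irrefl  : ∀ i → adj i i ≡ false
open Graph public

module _ {n : ℕ} (G : Graph n) where

  Adjacent : Fin n → Fin n → Set
  Adjacent i j = adj G i j ≡ true

  Independent : Subset n → Set
  Independent S = ∀ i j → i ∈ S → j ∈ S → adj G i j ≡ false

  IsAlpha : ℕ → Set
  IsAlpha a = (Σ (Subset n) λ S → Independent S × ∣ S ∣ ≡ a)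
            × (∀ S → Independent S → ∣ S ∣ ≤ a)

  IsMaxIndep : Subset n → Set
  IsMaxIndep S = Independent S × (∀ T → Independent T → ∣ T ∣ ≤ ∣ S ∣)

  IsCore : Subset n → Set
  IsCore C = ∀ x → (x ∈ C ⇔ (∀ S → IsMaxIndep S → x ∈ S))

  IsCorona : Subset n → Set
  IsCorona K = ∀ x → (x ∈ K ⇔ (Σ (Subset n) λ S → IsMaxIndep S × x ∈ S))

cyclicPairs : ∀ {n} → List (Fin n) → List (Fin n × Fin n)
cyclicPairs []       = []
cyclicPairs (v ∷ vs) = zip (v ∷ vs) (vs ++ [ v ])

record Cycle {n : ℕ} (G : Graph n) : Set where
  field
    verts     : List (Fin n)
    long      : 3 ≤ length verts
    distinct  : Unique verts
    adjacent  : All (λ p → Adjacent G (Data.Product.proj₁ p) (Data.Product.proj₂ p))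
                    (cyclicPairs verts)
open Cycle public

cycleLength : ∀ {n} {G : Graph n} → Cycle G → ℕ
cycleLength c = length (verts c)

IsOdd : ℕ → Set
IsOdd m = ∃ λ k → m ≡ 1 + 2 * k

HasEdge : ∀ {n} {G : Graph n} → Cycle G → Fin n → Fin n → Set
HasEdge c u v = ((u , v) ∈ₗ cyclicPairs (verts c)) ⊎ ((v , u) ∈ₗ cyclicPairs (verts c))

-- Two cycles are the same subgraph iff they have the same edge set
-- (the vertex set of a cycle is determined by its edge set).
SameCycle : ∀ {n} {G : Graph n} → Cycle G → Cycle G → Set
SameCycle c d = ∀ u v → (HasEdge c u v ⇔ HasEdge d u v)

OddCycle : ∀ {n} → Graph n → Set
OddCycle G = Σ (Cycle G) λ c → IsOdd (cycleLength c)

-- G has at most two odd cycles (counted as subgraphs):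
-- among any three odd cycles, two coincide.
AtMostTwoOddCycles : ∀ {n} → Graph n → Set
AtMostTwoOddCycles G = ∀ (c₁ c₂ c₃ : OddCycle G) →
  SameCycle (Data.Product.proj₁ c₁) (Data.Product.proj₁ c₂) ⊎
  SameCycle (Data.Product.proj₁ c₁) (Data.Product.proj₁ c₃) ⊎
  SameCycle (Data.Product.proj₁ c₂) (Data.Product.proj₁ c₃)

-- Lower bound: let A be an intersection and B a union of maximum independent
-- sets, and T another one.  No vertex of B is adjacent to A, so (T ∩ B) ∪ (A ─ T)
-- is independent; comparing its size with α = ∣T∣ gives ∣A ─ T∣ ≤ ∣T ─ B∣, hence
-- replacing (A, B) by (A ∩ T, B ∪ T) does not decrease ∣A∣ + ∣B∣.  Starting from
-- A = B = S with ∣S∣ = α and refining, for every vertex outside the core, by a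
-- maximum independent set missing it, A ends inside the core and B inside the
-- corona.
--
-- Upper bound: no vertex of the corona is adjacent to the core, so for every
-- independent subset I of D = corona ─ core the set I ∪ core is independent, and
-- ∣core∣ + ∣corona∣ = 2 ∣core∣ + ∣D∣ ≤ 2α + ∣D∣ − 2 ∣I∣.  It remains to find such
-- an I with ∣D∣ ≤ 2 ∣I∣ + 2.  If D spans no odd cycle, colour each vertex by the
-- parity of a walk to it from a root of its component: an edge with equally
-- coloured ends would close an odd walk, hence an odd cycle, so the larger
-- colour class will do.  Otherwise delete a vertex of an odd cycle in D, and if
-- need be a vertex of an odd cycle in what remains; a third odd cycle would
-- avoid both deleted vertices and so differ from the first two.
module Submission where

open import Defs
open import Data.Bool using (Bool; true; false)
open import Data.Bool.Properties using (¬-not) renaming (_≟_ to _≟ᵇ_)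
open import Data.Empty using (⊥)
open import Data.Fin using (Fin) renaming (_≟_ to _≟ᶠ_)
open import Data.Fin.Properties using (any?; all?)
open import Data.Fin.Subset
  using (Subset; _∈_; _∉_; _⊆_; ∣_∣; _∩_; _∪_; _─_; _-_; ⁅_⁆; inside; outside)
open import Data.Fin.Subset.Properties
  using (_∈?_; x∈p∪q⁻; p∩q⊆p; p∩q⊆q; p─q⊆p; x∈⁅x⁆; ∣p∩q∣≤∣q∣; ∣⁅x⁆∣≡1; p⊆q⇒∣p∣≤∣q∣;
         anySubset?)
open import Data.List using (List; []; _∷_; [_]; _++_; length; zip; allFin; filter)
open import Data.List.Properties using (++-assoc; length-++)
open import Data.List.Membership.Propositional using () renaming (_∈_ to _∈ₗ_)
open import Data.List.Membership.Propositional.Properties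
  using (∈-allFin; ∈-∃++; ∈-filter⁺; ∈-filter⁻; ∈-++⁻)
open import Data.List.Relation.Unary.All using (All; []; _∷_)
import Data.List.Relation.Unary.All as All
open import Data.List.Relation.Unary.All.Properties using (++⁺; ++⁻ˡ; ++⁻ʳ; ¬Any⇒All¬)
open import Data.List.Relation.Unary.AllPairs using ([]; _∷_)
open import Data.List.Relation.Unary.Any using (here; there)
import Data.List.Relation.Unary.Any as Any
open import Data.List.Relation.Unary.Linked using (Linked; []; [-]; _∷_)
open import Data.List.Relation.Unary.Unique.Propositional using (Unique)
open import Data.Nat using (ℕ; suc; _+_; _*_; _≤_; _<_; z≤n; s≤s; z<s; parity)
open import Data.Nat.Induction using (<-wellFounded)
open import Data.Nat.Properties
open import Data.Nat.Solver using (module +-*-Solver)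
open import Data.Parity using (Parity; 0ℙ; 1ℙ; _⁻¹) renaming (_+_ to _+ℙ_)
open import Data.Parity.Properties using (+-homo-+; p+p≡0ℙ) renaming (_≟_ to _≟ᵖ_)
open import Data.Product using (_×_; _,_; Σ; ∃; ∃₂; proj₁; proj₂)
import Data.Product as Product
open import Data.Sum using (_⊎_; inj₁; inj₂; [_,_]′)
import Data.Sum as Sum
open import Data.Vec using ([]; _∷_; here; there; tabulate)
open import Data.Vec.Properties using (lookup∘tabulate; []=⇒lookup; lookup⇒[]=)
open import Function using (id)
open import Function.Bundles using (Equivalence)
open import Induction.WellFounded using (Acc; acc)
open import Relation.Binary.Definitions using (DecidableEquality)
open import Relation.Binary.PropositionalEquality hiding ([_])
open import Relation.Nullary using (yes; no; does; contradiction)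
open import Relation.Nullary.Decidable using (_×-dec_; _→-dec_; ¬?; decidable-stable)
open import Relation.Unary using (Decidable)

private
  variable
    n : ℕ

x∈p─q⇒x∉q : ∀ (p q : Subset n) {x} → x ∈ p ─ q → x ∉ q
x∈p─q⇒x∉q (_ ∷ p) (outside ∷ q) here      ()
x∈p─q⇒x∉q (_ ∷ p) (_       ∷ q) (there m) (there m′) = x∈p─q⇒x∉q p q m m′

x∉p-x : ∀ (p : Subset n) x → x ∉ p - x
x∉p-x p x x∈p-x = x∈p─q⇒x∉q p ⁅ x ⁆ x∈p-x (x∈⁅x⁆ x)

∈-tabulate⁻ : ∀ {f : Fin n → Bool} {x} → x ∈ tabulate f → f x ≡ true
∈-tabulate⁻ {f = f} {x} x∈ = trans (sym (lookup∘tabulate f x)) ([]=⇒lookup x∈)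

∉-tabulate⁻ : ∀ {f : Fin n → Bool} {x} → x ∉ tabulate f → f x ≡ false
∉-tabulate⁻ {f = f} {x} x∉ = ¬-not λ fx≡true →
  x∉ (lookup⇒[]= x (tabulate f) (trans (lookup∘tabulate f x) fx≡true))

∣p∣≡∣p∩q∣+∣p─q∣ : ∀ (p q : Subset n) → ∣ p ∣ ≡ ∣ p ∩ q ∣ + ∣ p ─ q ∣
∣p∣≡∣p∩q∣+∣p─q∣ []            []            = refl
∣p∣≡∣p∩q∣+∣p─q∣ (inside  ∷ p) (inside  ∷ q) = cong suc (∣p∣≡∣p∩q∣+∣p─q∣ p q)
∣p∣≡∣p∩q∣+∣p─q∣ (inside  ∷ p) (outside ∷ q) =
  trans (cong suc (∣p∣≡∣p∩q∣+∣p─q∣ p q)) (sym (+-suc _ _))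
∣p∣≡∣p∩q∣+∣p─q∣ (outside ∷ p) (inside  ∷ q) = ∣p∣≡∣p∩q∣+∣p─q∣ p q
∣p∣≡∣p∩q∣+∣p─q∣ (outside ∷ p) (outside ∷ q) = ∣p∣≡∣p∩q∣+∣p─q∣ p q

∣p∪q∣≡∣p∣+∣q─p∣ : ∀ (p q : Subset n) → ∣ p ∪ q ∣ ≡ ∣ p ∣ + ∣ q ─ p ∣
∣p∪q∣≡∣p∣+∣q─p∣ []            []            = refl
∣p∪q∣≡∣p∣+∣q─p∣ (inside  ∷ p) (_       ∷ q) = cong suc (∣p∪q∣≡∣p∣+∣q─p∣ p q)
∣p∪q∣≡∣p∣+∣q─p∣ (outside ∷ p) (inside  ∷ q) =
  trans (cong suc (∣p∪q∣≡∣p∣+∣q─p∣ p q)) (sym (+-suc _ _))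
∣p∪q∣≡∣p∣+∣q─p∣ (outside ∷ p) (outside ∷ q) = ∣p∪q∣≡∣p∣+∣q─p∣ p q

∣p∪q∣≡∣p∣+∣q∣ : ∀ (p q : Subset n) → (∀ {x} → x ∈ p → x ∉ q) → ∣ p ∪ q ∣ ≡ ∣ p ∣ + ∣ q ∣
∣p∪q∣≡∣p∣+∣q∣ []            []            _        = refl
∣p∪q∣≡∣p∣+∣q∣ (inside  ∷ p) (inside  ∷ q) disjoint = contradiction here (disjoint here)
∣p∪q∣≡∣p∣+∣q∣ (inside  ∷ p) (outside ∷ q) disjoint =
  cong suc (∣p∪q∣≡∣p∣+∣q∣ p q λ x∈p x∈q → disjoint (there x∈p) (there x∈q))
∣p∪q∣≡∣p∣+∣q∣ (outside ∷ p) (inside  ∷ q) disjoint =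
  trans (cong suc (∣p∪q∣≡∣p∣+∣q∣ p q λ x∈p x∈q → disjoint (there x∈p) (there x∈q)))
        (sym (+-suc _ _))
∣p∪q∣≡∣p∣+∣q∣ (outside ∷ p) (outside ∷ q) disjoint =
  ∣p∪q∣≡∣p∣+∣q∣ p q λ x∈p x∈q → disjoint (there x∈p) (there x∈q)

∣p∣≤∣p-x∣+1 : ∀ (p : Subset n) x → ∣ p ∣ ≤ ∣ p - x ∣ + 1
∣p∣≤∣p-x∣+1 p x = begin
  ∣ p ∣                       ≡⟨ ∣p∣≡∣p∩q∣+∣p─q∣ p ⁅ x ⁆ ⟩
  ∣ p ∩ ⁅ x ⁆ ∣ + ∣ p - x ∣   ≤⟨ +-monoˡ-≤ _ (≤-trans (∣p∩q∣≤∣q∣ p ⁅ x ⁆) (≤-reflexive (∣⁅x⁆∣≡1 x))) ⟩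
  1 + ∣ p - x ∣               ≡⟨ +-comm 1 _ ⟩
  ∣ p - x ∣ + 1               ∎
  where open ≤-Reasoning

∣p∣≤2∣p∩q∣⊎∣p∣≤2∣p─q∣ : ∀ (p q : Subset n) → ∣ p ∣ ≤ 2 * ∣ p ∩ q ∣ ⊎ ∣ p ∣ ≤ 2 * ∣ p ─ q ∣
∣p∣≤2∣p∩q∣⊎∣p∣≤2∣p─q∣ p q
  rewrite ∣p∣≡∣p∩q∣+∣p─q∣ p q | +-identityʳ ∣ p ∩ q ∣ | +-identityʳ ∣ p ─ q ∣
  with ∣ p ∩ q ∣ ≤? ∣ p ─ q ∣
... | yes ∩≤─ = inj₂ (+-monoˡ-≤ _ ∩≤─)
... | no  ∩≰─ = inj₁ (+-monoʳ-≤ _ (<⇒≤ (≰⇒> ∩≰─)))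

module _ {A : Set} {R : A → A → Set} where

  linked-++⁻ : ∀ xs {y ys} → Linked R (xs ++ y ∷ ys) → Linked R (xs ++ [ y ]) × Linked R (y ∷ ys)
  linked-++⁻ []            l       = [-] , l
  linked-++⁻ (x ∷ [])      (r ∷ l) = r ∷ [-] , l
  linked-++⁻ (x ∷ x′ ∷ xs) (r ∷ l) = Product.map₁ (r ∷_) (linked-++⁻ (x′ ∷ xs) l)

  linked-++⁺ : ∀ xs {y ys} → Linked R (xs ++ [ y ]) → Linked R (y ∷ ys) → Linked R (xs ++ y ∷ ys)
  linked-++⁺ []            _         l = l
  linked-++⁺ (x ∷ [])      (r ∷ [-]) l = r ∷ l
  linked-++⁺ (x ∷ x′ ∷ xs) (r ∷ l′)  l = r ∷ linked-++⁺ (x′ ∷ xs) l′ l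

  linked-splitAtRepeat : ∀ xs x ys zs {h} → Linked R ((xs ++ x ∷ ys ++ x ∷ zs) ++ [ h ]) →
                         Linked R (x ∷ ys ++ [ x ]) × Linked R ((xs ++ x ∷ zs) ++ [ h ])
  linked-splitAtRepeat xs x ys zs {h} l =
    let prefix , suffix = linked-++⁻ xs (subst (Linked R) reassoc l)
        loop   , rest   = linked-++⁻ (x ∷ ys) suffix
    in loop , subst (Linked R) (sym (++-assoc xs (x ∷ zs) [ h ])) (linked-++⁺ xs prefix rest)
    where
    reassoc : (xs ++ x ∷ ys ++ x ∷ zs) ++ [ h ] ≡ xs ++ x ∷ ys ++ x ∷ zs ++ [ h ]
    reassoc = trans (++-assoc xs (x ∷ ys ++ x ∷ zs) [ h ])
                    (cong (λ t → xs ++ x ∷ t) (++-assoc ys (x ∷ zs) [ h ]))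

  linked⇒All-zip : ∀ x vs {w} → Linked R (x ∷ vs ++ [ w ]) →
                   All (λ p → R (proj₁ p) (proj₂ p)) (zip (x ∷ vs) (vs ++ [ w ]))
  linked⇒All-zip x []       (r ∷ [-]) = r ∷ []
  linked⇒All-zip x (y ∷ vs) (r ∷ l)   = r ∷ linked⇒All-zip y vs l

module _ {A : Set} where

  All-splitAtRepeat : ∀ {P : A → Set} xs x ys zs → All P (xs ++ x ∷ ys ++ x ∷ zs) →
                      All P (x ∷ ys) × All P (xs ++ x ∷ zs)
  All-splitAtRepeat xs x ys zs all with px ∷ rest ← ++⁻ʳ xs all =
    px ∷ ++⁻ˡ ys rest , ++⁺ (++⁻ˡ xs all) (++⁻ʳ ys rest)

  length-splitAtRepeat : ∀ (xs : List A) x ys zs →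
                         length (xs ++ x ∷ ys ++ x ∷ zs) ≡ length (x ∷ ys) + length (xs ++ x ∷ zs)
  length-splitAtRepeat xs x ys zs
    rewrite length-++ xs {x ∷ ys ++ x ∷ zs} | length-++ ys {x ∷ zs} | length-++ xs {x ∷ zs}
    = solve 3 (λ a b c → a :+ (con 1 :+ (b :+ (con 1 :+ c))) := con 1 :+ b :+ (a :+ (con 1 :+ c)))
              refl (length xs) (length ys) (length zs)
    where open +-*-Solver

  0<length-++∷ : ∀ (xs : List A) x zs → 0 < length (xs ++ x ∷ zs)
  0<length-++∷ []      _ _ = z<s
  0<length-++∷ (_ ∷ _) _ _ = z<s

  Repeat : List A → Set
  Repeat V = ∃ λ xs → ∃ λ x → ∃ λ ys → ∃ λ zs → V ≡ xs ++ x ∷ ys ++ x ∷ zs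

  unique⊎repeat : DecidableEquality A → ∀ V → Unique V ⊎ Repeat V
  unique⊎repeat _≟_ []      = inj₁ []
  unique⊎repeat _≟_ (x ∷ V) with Any.any? (x ≟_) V
  ... | yes x∈V with ys , zs , refl ← ∈-∃++ x∈V = inj₂ ([] , x , ys , zs , refl)
  ... | no  x∉V with unique⊎repeat _≟_ V
  ...   | inj₁ unique                    = inj₁ (¬Any⇒All¬ V x∉V ∷ unique)
  ...   | inj₂ (xs , y , ys , zs , refl) = inj₂ (x ∷ xs , y , ys , zs , refl)

  module _ {B : Set} where

    ∈-zip⁻ : ∀ (xs : List A) (ys : List B) {x y} → (x , y) ∈ₗ zip xs ys → x ∈ₗ xs × y ∈ₗ ys
    ∈-zip⁻ (x ∷ xs) (y ∷ ys) (here refl) = here refl , here refl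
    ∈-zip⁻ (x ∷ xs) (y ∷ ys) (there xy∈) = Product.map there there (∈-zip⁻ xs ys xy∈)

∈-cyclicPairs⁻ : ∀ (vs : List (Fin n)) {x y} → (x , y) ∈ₗ cyclicPairs vs → x ∈ₗ vs × y ∈ₗ vs
∈-cyclicPairs⁻ (v ∷ vs) xy∈ with x∈ , y∈ ← ∈-zip⁻ (v ∷ vs) (vs ++ [ v ]) xy∈ =
  x∈ , [ there , (λ { (here refl) → here refl }) ]′ (∈-++⁻ vs y∈)

parity≡1ℙ⇒IsOdd : ∀ m → parity m ≡ 1ℙ → IsOdd m
parity≡1ℙ⇒IsOdd 1             _   = 0 , refl
parity≡1ℙ⇒IsOdd (suc (suc m)) odd with k , refl ← parity≡1ℙ⇒IsOdd m odd =
  suc k , cong suc (sym (*-suc 2 k))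

parity-+-odd : ∀ m k → parity (m + k) ≡ 1ℙ → parity m ≡ 1ℙ ⊎ parity k ≡ 1ℙ
parity-+-odd m k odd with parity m | parity k | trans (sym (+-homo-+ m k)) odd
... | 1ℙ | _ | _   = inj₁ refl
... | 0ℙ | _ | odd = inj₂ odd

module _ (G : Graph n) where

  NoEdgeBetween : Subset n → Subset n → Set
  NoEdgeBetween A B = ∀ i j → i ∈ A → j ∈ B → adj G i j ≡ false

  NoEdgeBetween-sym : ∀ {A B} → NoEdgeBetween A B → NoEdgeBetween B A
  NoEdgeBetween-sym h i j i∈B j∈A = trans (symm G i j) (h j i j∈A i∈B)

  NoEdgeBetween-mono : ∀ {A A′ B B′} → A′ ⊆ A → B′ ⊆ B → NoEdgeBetween A B → NoEdgeBetween A′ B′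
  NoEdgeBetween-mono A′⊆A B′⊆B h i j i∈A′ j∈B′ = h i j (A′⊆A i∈A′) (B′⊆B j∈B′)

  NoEdgeBetween-∪ʳ : ∀ {A B B′} → NoEdgeBetween A B → NoEdgeBetween A B′ → NoEdgeBetween A (B ∪ B′)
  NoEdgeBetween-∪ʳ {B = B} {B′} h h′ i j i∈A j∈B∪B′ with x∈p∪q⁻ B B′ j∈B∪B′
  ... | inj₁ j∈B  = h  i j i∈A j∈B
  ... | inj₂ j∈B′ = h′ i j i∈A j∈B′

  NoEdgeBetween-∪ˡ : ∀ {A A′ B} → NoEdgeBetween A B → NoEdgeBetween A′ B → NoEdgeBetween (A ∪ A′) B
  NoEdgeBetween-∪ˡ h h′ =
    NoEdgeBetween-sym (NoEdgeBetween-∪ʳ (NoEdgeBetween-sym h) (NoEdgeBetween-sym h′))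

  independent-∪ : ∀ {A B} → Independent G A → Independent G B → NoEdgeBetween A B →
                  Independent G (A ∪ B)
  independent-∪ indA indB h =
    NoEdgeBetween-∪ˡ (NoEdgeBetween-∪ʳ indA h) (NoEdgeBetween-∪ʳ (NoEdgeBetween-sym h) indB)

  independent-⊆ : ∀ {A B} → A ⊆ B → Independent G B → Independent G A
  independent-⊆ A⊆B = NoEdgeBetween-mono A⊆B A⊆B

  independent? : Decidable (Independent G)
  independent? S = all? λ i → all? λ j → (i ∈? S) →-dec (j ∈? S) →-dec (adj G i j ≟ᵇ false)

  record LargeIndependentSubset (D : Subset n) (k : ℕ) : Set where
    field
      I             : Subset n
      I⊆D           : I ⊆ D
      I-independent : Independent G I
      ∣D∣≤2∣I∣+k    : ∣ D ∣ ≤ 2 * ∣ I ∣ + k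

  largeIndependent-weaken : ∀ {D k k′} → k ≤ k′ → LargeIndependentSubset D k →
                            LargeIndependentSubset D k′
  largeIndependent-weaken k≤k′ large = record
    { I             = I
    ; I⊆D           = I⊆D
    ; I-independent = I-independent
    ; ∣D∣≤2∣I∣+k    = ≤-trans ∣D∣≤2∣I∣+k (+-monoʳ-≤ (2 * ∣ I ∣) k≤k′)
    }
    where open LargeIndependentSubset large

  largeIndependent-delete : ∀ {D x k} → LargeIndependentSubset (D - x) k →
                            LargeIndependentSubset D (suc k)
  largeIndependent-delete {D} {x} {k} large = record
    { I             = I
    ; I⊆D           = λ u∈I → p─q⊆p D ⁅ x ⁆ (I⊆D u∈I)
    ; I-independent = I-independent
    ; ∣D∣≤2∣I∣+k    = begin
        ∣ D ∣                ≤⟨ ∣p∣≤∣p-x∣+1 D x ⟩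
        ∣ D - x ∣ + 1        ≤⟨ +-monoˡ-≤ 1 ∣D∣≤2∣I∣+k ⟩
        2 * ∣ I ∣ + k + 1    ≡⟨ +-assoc (2 * ∣ I ∣) k 1 ⟩
        2 * ∣ I ∣ + (k + 1)  ≡⟨ cong (2 * ∣ I ∣ +_) (+-comm k 1) ⟩
        2 * ∣ I ∣ + suc k    ∎
    }
    where
    open LargeIndependentSubset large
    open ≤-Reasoning

  bipartition⇒largeIndependent : ∀ {D F} → Independent G (D ∩ F) → Independent G (D ─ F) →
                                 LargeIndependentSubset D 0
  bipartition⇒largeIndependent {D} {F} ind∩ ind─ with ∣p∣≤2∣p∩q∣⊎∣p∣≤2∣p─q∣ D F
  ... | inj₁ ∣D∣≤2∣D∩F∣ = record
        { I = D ∩ F ; I⊆D = p∩q⊆p D F ; I-independent = ind∩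
        ; ∣D∣≤2∣I∣+k = subst (∣ D ∣ ≤_) (sym (+-identityʳ _)) ∣D∣≤2∣D∩F∣ }
  ... | inj₂ ∣D∣≤2∣D─F∣ = record
        { I = D ─ F ; I⊆D = p─q⊆p D F ; I-independent = ind─
        ; ∣D∣≤2∣I∣+k = subst (∣ D ∣ ≤_) (sym (+-identityʳ _)) ∣D∣≤2∣D─F∣ }

  ProperColouring : Subset n → (Fin n → Parity) → Set
  ProperColouring D c = ∀ {u u′} → u ∈ D → u′ ∈ D → Adjacent G u u′ → c u ≢ c u′

  properColouring⇒largeIndependent : ∀ {D c} → ProperColouring D c → LargeIndependentSubset D 0
  properColouring⇒largeIndependent {D} {c} proper = bipartition⇒largeIndependent
    (monochromatic⇒independent (p∩q⊆p D F) λ i∈ j∈ →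
       trans (∈-tabulate⁻ (p∩q⊆q D F i∈)) (sym (∈-tabulate⁻ (p∩q⊆q D F j∈))))
    (monochromatic⇒independent (p─q⊆p D F) λ i∈ j∈ →
       trans (∉-tabulate⁻ (x∈p─q⇒x∉q D F i∈)) (sym (∉-tabulate⁻ (x∈p─q⇒x∉q D F j∈))))
    where
    odd? : Fin n → Bool
    odd? u = does (c u ≟ᵖ 1ℙ)
    F : Subset n
    F = tabulate odd?
    odd?-injective : ∀ {u u′} → odd? u ≡ odd? u′ → c u ≡ c u′
    odd?-injective {u} {u′} with c u | c u′
    ... | 0ℙ | 0ℙ = λ _ → refl
    ... | 1ℙ | 1ℙ = λ _ → refl
    ... | 0ℙ | 1ℙ = λ ()
    ... | 1ℙ | 0ℙ = λ ()
    monochromatic⇒independent : ∀ {S} → S ⊆ D → (∀ {i j} → i ∈ S → j ∈ S → odd? i ≡ odd? j) →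
                                Independent G S
    monochromatic⇒independent S⊆D same i j i∈S j∈S =
      ¬-not λ i~j → proper (S⊆D i∈S) (S⊆D j∈S) i~j (odd?-injective (same i∈S j∈S))

module MaximumIndependentSets (G : Graph n) {a : ℕ} (α : IsAlpha G a) where

  ∣S∣≡a⇒maxIndep : ∀ {S} → Independent G S → ∣ S ∣ ≡ a → IsMaxIndep G S
  ∣S∣≡a⇒maxIndep indS refl = indS , proj₂ α

  maxIndep⇒∣S∣≡a : ∀ {S} → IsMaxIndep G S → ∣ S ∣ ≡ a
  maxIndep⇒∣S∣≡a (indS , maxS) with proj₁ α
  ... | S₀ , indS₀ , refl = ≤-antisym (proj₂ α _ indS) (maxS S₀ indS₀)

  someMaxIndep : Σ (Subset n) (IsMaxIndep G)
  someMaxIndep with proj₁ α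
  ... | S₀ , indS₀ , ∣S₀∣≡a = S₀ , ∣S∣≡a⇒maxIndep indS₀ ∣S₀∣≡a

  exchange : ∀ {A B T} → Independent G A → NoEdgeBetween G B A → IsMaxIndep G T →
             ∣ A ─ T ∣ ≤ ∣ T ─ B ∣
  exchange {A} {B} {T} indA noEdge maxT@(indT , _) = +-cancelˡ-≤ ∣ T ∩ B ∣ _ _ (begin
    ∣ T ∩ B ∣ + ∣ A ─ T ∣  ≡⟨ ∣p∪q∣≡∣p∣+∣q∣ (T ∩ B) (A ─ T) disjoint ⟨
    ∣ (T ∩ B) ∪ (A ─ T) ∣  ≤⟨ proj₂ α _ independent ⟩
    a                      ≡⟨ maxIndep⇒∣S∣≡a maxT ⟨
    ∣ T ∣                  ≡⟨ ∣p∣≡∣p∩q∣+∣p─q∣ T B ⟩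
    ∣ T ∩ B ∣ + ∣ T ─ B ∣  ∎)
    where
    open ≤-Reasoning
    disjoint : ∀ {x} → x ∈ T ∩ B → x ∉ A ─ T
    disjoint x∈T∩B x∈A─T = x∈p─q⇒x∉q A T x∈A─T (p∩q⊆p T B x∈T∩B)
    independent : Independent G ((T ∩ B) ∪ (A ─ T))
    independent = independent-∪ G (independent-⊆ G (p∩q⊆p T B) indT)
                                  (independent-⊆ G (p─q⊆p A T) indA)
                                  (NoEdgeBetween-mono G (p∩q⊆q T B) (p─q⊆p A T) noEdge)

  ∣A∣+∣B∣≤∣A∩T∣+∣B∪T∣ : ∀ {A B T} → Independent G A → NoEdgeBetween G B A → IsMaxIndep G T →
                        ∣ A ∣ + ∣ B ∣ ≤ ∣ A ∩ T ∣ + ∣ B ∪ T ∣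
  ∣A∣+∣B∣≤∣A∩T∣+∣B∪T∣ {A} {B} {T} indA noEdge maxT = begin
    ∣ A ∣ + ∣ B ∣                    ≡⟨ cong (_+ ∣ B ∣) (∣p∣≡∣p∩q∣+∣p─q∣ A T) ⟩
    ∣ A ∩ T ∣ + ∣ A ─ T ∣ + ∣ B ∣    ≤⟨ +-monoˡ-≤ ∣ B ∣ (+-monoʳ-≤ ∣ A ∩ T ∣ (exchange indA noEdge maxT)) ⟩
    ∣ A ∩ T ∣ + ∣ T ─ B ∣ + ∣ B ∣    ≡⟨ +-assoc ∣ A ∩ T ∣ _ _ ⟩
    ∣ A ∩ T ∣ + (∣ T ─ B ∣ + ∣ B ∣)  ≡⟨ cong (∣ A ∩ T ∣ +_) (+-comm _ ∣ B ∣) ⟩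
    ∣ A ∩ T ∣ + (∣ B ∣ + ∣ T ─ B ∣)  ≡⟨ cong (∣ A ∩ T ∣ +_) (∣p∪q∣≡∣p∣+∣q─p∣ B T) ⟨
    ∣ A ∩ T ∣ + ∣ B ∪ T ∣            ∎
    where open ≤-Reasoning

module CoreCorona (G : Graph n) {a : ℕ} {C K : Subset n}
                  (α : IsAlpha G a) (core : IsCore G C) (corona : IsCorona G K) where

  open MaximumIndependentSets G α

  maxIndep⊆corona : ∀ {S} → IsMaxIndep G S → S ⊆ K
  maxIndep⊆corona {S} maxS {x} x∈S = Equivalence.from (corona x) (S , maxS , x∈S)

  core⊆maxIndep : ∀ {S} → IsMaxIndep G S → C ⊆ S
  core⊆maxIndep maxS {x} x∈C = Equivalence.to (core x) x∈C _ maxS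

  core-independent : Independent G C
  core-independent with S , maxS ← someMaxIndep = independent-⊆ G (core⊆maxIndep maxS) (proj₁ maxS)

  NoEdgeBetween-corona-core : NoEdgeBetween G K C
  NoEdgeBetween-corona-core i j i∈K j∈C with S , maxS , i∈S ← Equivalence.to (corona i) i∈K =
    proj₁ maxS i j i∈S (core⊆maxIndep maxS j∈C)

  ∉core⇒avoidingMaxIndep : ∀ {x} → x ∉ C → Σ (Subset n) λ T → IsMaxIndep G T × x ∉ T
  ∉core⇒avoidingMaxIndep {x} x∉C
    with anySubset? (λ T → independent? G T ×-dec (∣ T ∣ ≟ a) ×-dec ¬? (x ∈? T))
  ... | yes (T , indT , ∣T∣≡a , x∉T) = T , ∣S∣≡a⇒maxIndep indT ∣T∣≡a , x∉T
  ... | no ∄T = contradiction (Equivalence.from (core x) λ S maxS →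
          decidable-stable (x ∈? S) λ x∉S → ∄T (S , proj₁ maxS , maxIndep⇒∣S∣≡a maxS , x∉S)) x∉C

  record Approximation (A B : Subset n) : Set where
    field
      A-independent : Independent G A
      noEdge        : NoEdgeBetween G B A
      B⊆K           : B ⊆ K
      2a≤∣A∣+∣B∣    : 2 * a ≤ ∣ A ∣ + ∣ B ∣

  approximation-init : ∀ {S} → IsMaxIndep G S → Approximation S S
  approximation-init {S} maxS@(indS , _) = record
    { A-independent = indS
    ; noEdge        = indS
    ; B⊆K           = maxIndep⊆corona maxS
    ; 2a≤∣A∣+∣B∣    = ≤-reflexive (begin-equality
        2 * a          ≡⟨ cong (a +_) (+-identityʳ a) ⟩
        a + a          ≡⟨ cong₂ _+_ (maxIndep⇒∣S∣≡a maxS) (maxIndep⇒∣S∣≡a maxS) ⟨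
        ∣ S ∣ + ∣ S ∣  ∎)
    }
    where open ≤-Reasoning

  approximation-refine : ∀ {A B T} → Approximation A B → IsMaxIndep G T →
                         Approximation (A ∩ T) (B ∪ T)
  approximation-refine {A} {B} {T} approx maxT@(indT , _) = record
    { A-independent = independent-⊆ G (p∩q⊆p A T) A-independent
    ; noEdge        = NoEdgeBetween-∪ˡ G (NoEdgeBetween-mono G id (p∩q⊆p A T) noEdge)
                                         (NoEdgeBetween-mono G id (p∩q⊆q A T) indT)
    ; B⊆K           = λ x∈B∪T → [ B⊆K , maxIndep⊆corona maxT ]′ (x∈p∪q⁻ B T x∈B∪T)
    ; 2a≤∣A∣+∣B∣    = ≤-trans 2a≤∣A∣+∣B∣ (∣A∣+∣B∣≤∣A∩T∣+∣B∪T∣ A-independent noEdge maxT)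
    }
    where open Approximation approx

  approximation : ∀ (L : List (Fin n)) →
                  ∃₂ λ A B → Approximation A B × (∀ {x} → x ∈ₗ L → x ∈ A → x ∈ C)
  approximation [] = _ , _ , approximation-init (proj₂ someMaxIndep) , λ ()
  approximation (x ∷ L) with approximation L | x ∈? C
  ... | A , B , approx , sound | yes x∈C =
        A , B , approx , λ { (here refl) _ → x∈C ; (there y∈L) → sound y∈L }
  ... | A , B , approx , sound | no x∉C with T , maxT , x∉T ← ∉core⇒avoidingMaxIndep x∉C =
        A ∩ T , B ∪ T , approximation-refine approx maxT , λ
          { (here refl) x∈A∩T → contradiction (p∩q⊆q A T x∈A∩T) x∉T
          ; (there y∈L) y∈A∩T → sound y∈L (p∩q⊆p A T y∈A∩T) }

  2α≤∣core∣+∣corona∣ : 2 * a ≤ ∣ C ∣ + ∣ K ∣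
  2α≤∣core∣+∣corona∣ with A , B , approx , sound ← approximation (allFin n) =
    ≤-trans 2a≤∣A∣+∣B∣ (+-mono-≤ (p⊆q⇒∣p∣≤∣q∣ (sound (∈-allFin _))) (p⊆q⇒∣p∣≤∣q∣ B⊆K))
    where open Approximation approx

  ∣core∣+∣corona∣≤2α+k : ∀ {k} → LargeIndependentSubset G (K ─ C) k → ∣ C ∣ + ∣ K ∣ ≤ 2 * a + k
  ∣core∣+∣corona∣≤2α+k {k} large = begin
    ∣ C ∣ + ∣ K ∣                      ≤⟨ +-monoʳ-≤ ∣ C ∣ ∣K∣≤∣C∣+∣K─C∣ ⟩
    ∣ C ∣ + (∣ C ∣ + ∣ K ─ C ∣)        ≤⟨ +-monoʳ-≤ ∣ C ∣ (+-monoʳ-≤ ∣ C ∣ ∣D∣≤2∣I∣+k) ⟩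
    ∣ C ∣ + (∣ C ∣ + (2 * ∣ I ∣ + k))  ≡⟨ regroup ∣ C ∣ ∣ I ∣ k ⟩
    2 * (∣ I ∣ + ∣ C ∣) + k            ≤⟨ +-monoˡ-≤ k (*-monoʳ-≤ 2 ∣I∣+∣C∣≤a) ⟩
    2 * a + k                          ∎
    where
    open LargeIndependentSubset large
    open ≤-Reasoning
    ∣K∣≤∣C∣+∣K─C∣ : ∣ K ∣ ≤ ∣ C ∣ + ∣ K ─ C ∣
    ∣K∣≤∣C∣+∣K─C∣ = ≤-trans (≤-reflexive (∣p∣≡∣p∩q∣+∣p─q∣ K C)) (+-monoˡ-≤ _ (∣p∩q∣≤∣q∣ K C))
    I∪C-independent : Independent G (I ∪ C)
    I∪C-independent = independent-∪ G I-independent core-independent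
      (NoEdgeBetween-mono G (λ x∈I → p─q⊆p K C (I⊆D x∈I)) id NoEdgeBetween-corona-core)
    ∣I∣+∣C∣≤a : ∣ I ∣ + ∣ C ∣ ≤ a
    ∣I∣+∣C∣≤a = subst (_≤ a) (∣p∪q∣≡∣p∣+∣q∣ I C λ x∈I → x∈p─q⇒x∉q K C (I⊆D x∈I))
                      (proj₂ α _ I∪C-independent)
    regroup : ∀ c i k → c + (c + (2 * i + k)) ≡ 2 * (i + c) + k
    regroup = solve 3 (λ c i k → c :+ (c :+ (con 2 :* i :+ k)) := con 2 :* (i :+ c) :+ k) refl
      where open +-*-Solver
module Walks (G : Graph n) where

  Adjacent-sym : ∀ {x y} → Adjacent G x y → Adjacent G y x
  Adjacent-sym {x} {y} x~y = trans (symm G y x) x~y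

  data Walk (P : Fin n → Set) : Fin n → Fin n → Set where
    nil  : ∀ {x} → P x → Walk P x x
    cons : ∀ {x y z} → P x → Adjacent G x y → Walk P y z → Walk P x z

  module _ {P : Fin n → Set} where

    len : ∀ {x y} → Walk P x y → ℕ
    len (nil _)      = 0
    len (cons _ _ w) = suc (len w)

    infixr 5 _++ᵂ_
    _++ᵂ_ : ∀ {x y z} → Walk P x y → Walk P y z → Walk P x z
    nil _      ++ᵂ w′ = w′
    cons p e w ++ᵂ w′ = cons p e (w ++ᵂ w′)

    len-++ᵂ : ∀ {x y z} (w : Walk P x y) (w′ : Walk P y z) → len (w ++ᵂ w′) ≡ len w + len w′
    len-++ᵂ (nil _)      _  = refl
    len-++ᵂ (cons _ _ w) w′ = cong suc (len-++ᵂ w w′)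

    first : ∀ {x y} → Walk P x y → P x
    first (nil p)      = p
    first (cons p _ _) = p

    last : ∀ {x y} → Walk P x y → P y
    last (nil p)      = p
    last (cons _ _ w) = last w

    reverse : ∀ {x y} → Walk P x y → Walk P y x
    reverse (nil p)      = nil p
    reverse (cons p e w) = reverse w ++ᵂ cons (first w) (Adjacent-sym e) (nil p)

    len-reverse : ∀ {x y} (w : Walk P x y) → len (reverse w) ≡ len w
    len-reverse (nil _)      = refl
    len-reverse (cons p e w) = begin
      len (reverse w ++ᵂ cons (first w) (Adjacent-sym e) (nil p)) ≡⟨ len-++ᵂ (reverse w) _ ⟩
      len (reverse w) + 1                                         ≡⟨ +-comm _ 1 ⟩
      suc (len (reverse w))                                       ≡⟨ cong suc (len-reverse w) ⟩
      suc (len w)                                                 ∎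
      where open ≡-Reasoning

    vertices : ∀ {x y} → Walk P x y → List (Fin n)
    vertices (nil _)          = []
    vertices {x} (cons _ _ w) = x ∷ vertices w

    length-vertices : ∀ {x y} (w : Walk P x y) → length (vertices w) ≡ len w
    length-vertices (nil _)      = refl
    length-vertices (cons _ _ w) = cong suc (length-vertices w)

    All-vertices : ∀ {x y} (w : Walk P x y) → All P (vertices w)
    All-vertices (nil _)      = []
    All-vertices (cons p _ w) = p ∷ All-vertices w

    linked-vertices : ∀ {x y} (w : Walk P x y) → Linked (Adjacent G) (vertices w ++ [ y ])
    linked-vertices (nil _)                   = [-]
    linked-vertices (cons _ e (nil _))        = e ∷ [-]
    linked-vertices (cons _ e w@(cons _ _ _)) = e ∷ linked-vertices w

  mapᵂ : ∀ {P Q : Fin n → Set} → (∀ {z} → P z → Q z) → ∀ {x y} → Walk P x y → Walk Q x y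
  mapᵂ f (nil p)      = nil (f p)
  mapᵂ f (cons p e w) = cons (f p) e (mapᵂ f w)

  OddCycleIn : (Fin n → Set) → Set
  OddCycleIn P = Σ (Cycle G) λ c → IsOdd (cycleLength c) × All P (verts c)

  CyclicallyLinked : List (Fin n) → Set
  CyclicallyLinked []       = ⊥
  CyclicallyLinked (v ∷ vs) = Linked (Adjacent G) (v ∷ vs ++ [ v ])

  cyclicallyLinked-splitAtRepeat : ∀ xs x ys zs → CyclicallyLinked (xs ++ x ∷ ys ++ x ∷ zs) →
                                   CyclicallyLinked (x ∷ ys) × CyclicallyLinked (xs ++ x ∷ zs)
  cyclicallyLinked-splitAtRepeat []       x ys zs = linked-splitAtRepeat [] x ys zs
  cyclicallyLinked-splitAtRepeat (w ∷ xs) x ys zs = linked-splitAtRepeat (w ∷ xs) x ys zs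

  module _ {P : Fin n → Set} where

    uniqueOddCyclicList⇒oddCycle : ∀ V → Unique V → CyclicallyLinked V → All P V →
                                   parity (length V) ≡ 1ℙ → OddCycleIn P
    uniqueOddCyclicList⇒oddCycle (x ∷ []) _ (x~x ∷ [-]) _ _ =
      contradiction (trans (sym x~x) (irrefl G x)) λ ()
    uniqueOddCyclicList⇒oddCycle (x ∷ y ∷ z ∷ vs) unique linked all odd =
      record { verts    = x ∷ y ∷ z ∷ vs
             ; long     = s≤s (s≤s (s≤s z≤n))
             ; distinct = unique
             ; adjacent = linked⇒All-zip x (y ∷ z ∷ vs) linked }
      , parity≡1ℙ⇒IsOdd _ odd , all

    oddCyclicList⇒oddCycle : ∀ V → Acc _<_ (length V) → CyclicallyLinked V → All P V →
                             parity (length V) ≡ 1ℙ → OddCycleIn P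
    oddCyclicList⇒oddCycle V (acc shorter) linked all odd with unique⊎repeat _≟ᶠ_ V
    ... | inj₁ unique = uniqueOddCyclicList⇒oddCycle V unique linked all odd
    ... | inj₂ (xs , x , ys , zs , refl)
      with linked₁ , linked₂ ← cyclicallyLinked-splitAtRepeat xs x ys zs linked
      with all₁ , all₂ ← All-splitAtRepeat xs x ys zs all
      with parity-+-odd (length (x ∷ ys)) (length (xs ++ x ∷ zs))
                        (trans (cong parity (sym (length-splitAtRepeat xs x ys zs))) odd)
    ... | inj₁ odd₁ = oddCyclicList⇒oddCycle (x ∷ ys) (shorter shorter₁) linked₁ all₁ odd₁
      where
      shorter₁ : length (x ∷ ys) < length (xs ++ x ∷ ys ++ x ∷ zs)
      shorter₁ = subst (length (x ∷ ys) <_) (sym (length-splitAtRepeat xs x ys zs))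
                       (m<m+n (length (x ∷ ys)) (0<length-++∷ xs x zs))
    ... | inj₂ odd₂ = oddCyclicList⇒oddCycle (xs ++ x ∷ zs) (shorter shorter₂) linked₂ all₂ odd₂
      where
      shorter₂ : length (xs ++ x ∷ zs) < length (xs ++ x ∷ ys ++ x ∷ zs)
      shorter₂ = subst (length (xs ++ x ∷ zs) <_) (sym (length-splitAtRepeat xs x ys zs))
                       (m<n+m (length (xs ++ x ∷ zs)) z<s)

    oddClosedWalk⇒oddCycle : ∀ {x} (w : Walk P x x) → parity (len w) ≡ 1ℙ → OddCycleIn P
    oddClosedWalk⇒oddCycle w@(cons _ _ _) odd =
      oddCyclicList⇒oddCycle (vertices w) (<-wellFounded _) (linked-vertices w) (All-vertices w)
                             (trans (cong parity (length-vertices w)) odd)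

    sameParityEdge⇒oddCycle : ∀ {r r′ u u′} (w : Walk P r u) (w′ : Walk P r′ u′) → r ≡ r′ →
                              Adjacent G u u′ → parity (len w) ≡ parity (len w′) → OddCycleIn P
    sameParityEdge⇒oddCycle w w′ refl u~u′ same =
      oddClosedWalk⇒oddCycle (cons (last w) u~u′ (reverse w′ ++ᵂ w)) (begin
        parity (1 + len (reverse w′ ++ᵂ w))      ≡⟨ cong (λ l → parity (1 + l)) (len-++ᵂ (reverse w′) w) ⟩
        parity (1 + (len (reverse w′) + len w))  ≡⟨ cong (λ l → parity (1 + (l + len w))) (len-reverse w′) ⟩
        parity (1 + (len w′ + len w))            ≡⟨ +-homo-+ 1 (len w′ + len w) ⟩
        parity (len w′ + len w) ⁻¹               ≡⟨ cong _⁻¹ (+-homo-+ (len w′) (len w)) ⟩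
        (parity (len w′) +ℙ parity (len w)) ⁻¹   ≡⟨ cong (λ p → (p +ℙ parity (len w)) ⁻¹) same ⟨
        (parity (len w) +ℙ parity (len w)) ⁻¹    ≡⟨ cong _⁻¹ (p+p≡0ℙ (parity (len w))) ⟩
        1ℙ                                       ∎)
      where open ≡-Reasoning

module Rootings (G : Graph n) where

  open Walks G

  record Rooting (Q : Fin n → Set) : Set where
    field
      root          : Fin n → Fin n
      walk          : ∀ {u} → Q u → Walk Q (root u) u
      root-resp-adj : ∀ {u u′} → Q u → Q u′ → Adjacent G u u′ → root u ≡ root u′

  Rooting-map : ∀ {P Q : Fin n → Set} → (∀ {u} → P u → Q u) → (∀ {u} → Q u → P u) →
                Rooting P → Rooting Q
  Rooting-map to from R = record
    { root          = root
    ; walk          = λ q → mapᵂ to (walk (from q))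
    ; root-resp-adj = λ q q′ → root-resp-adj (from q) (from q′)
    }
    where open Rooting R

  -- Adding v merges v and all components meeting a neighbour of v into one
  -- component rooted at v.
  module Extend {L : List (Fin n)} (R : Rooting (_∈ₗ L)) (v : Fin n) where

    open Rooting R

    Reached : Fin n → Set
    Reached r = ∃ λ a → a ∈ₗ L × Adjacent G v a × root a ≡ r

    reached? : Decidable Reached
    reached? r = any? λ a → Any.any? (a ≟ᶠ_) L ×-dec (adj G v a ≟ᵇ true) ×-dec (root a ≟ᶠ r)

    reroot : Fin n → Fin n
    reroot r with reached? r
    ... | yes _ = v
    ... | no  _ = r

    reroot-reached : ∀ {r} → Reached r → reroot r ≡ v
    reroot-reached {r} reached with reached? r
    ... | yes _         = refl
    ... | no  unreached = contradiction reached unreached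

    root′ : Fin n → Fin n
    root′ u with u ≟ᶠ v
    ... | yes _ = v
    ... | no  _ = reroot (root u)

    ∈-tail : ∀ {u} → u ∈ₗ v ∷ L → u ≢ v → u ∈ₗ L
    ∈-tail (here u≡v)  u≢v = contradiction u≡v u≢v
    ∈-tail (there u∈L) _   = u∈L

    walk′ : ∀ {u} → u ∈ₗ v ∷ L → Walk (_∈ₗ v ∷ L) (root′ u) u
    walk′ {u} u∈vL with u ≟ᶠ v
    ... | yes refl = nil (here refl)
    ... | no  u≢v with reached? (root u)
    ...   | yes (a , a∈L , v~a , ra≡ru) =
            cons (here refl) v~a (mapᵂ there (subst (Walk _ a) ra≡ru (reverse (walk a∈L)) ++ᵂ walk u∈L))
      where u∈L = ∈-tail u∈vL u≢v
    ...   | no  _ = mapᵂ there (walk (∈-tail u∈vL u≢v))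

    root′-resp-adj : ∀ {u u′} → u ∈ₗ v ∷ L → u′ ∈ₗ v ∷ L → Adjacent G u u′ → root′ u ≡ root′ u′
    root′-resp-adj {u} {u′} u∈vL u′∈vL u~u′ with u ≟ᶠ v | u′ ≟ᶠ v
    ... | yes _    | yes _    = refl
    ... | yes refl | no  u′≢v = sym (reroot-reached (u′ , ∈-tail u′∈vL u′≢v , u~u′ , refl))
    ... | no  u≢v  | yes refl = reroot-reached (u , ∈-tail u∈vL u≢v , Adjacent-sym u~u′ , refl)
    ... | no  u≢v  | no  u′≢v =
          cong reroot (root-resp-adj (∈-tail u∈vL u≢v) (∈-tail u′∈vL u′≢v) u~u′)

    rooting′ : Rooting (_∈ₗ v ∷ L)
    rooting′ = record { root = root′ ; walk = walk′ ; root-resp-adj = root′-resp-adj }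

  rooting : ∀ L → Rooting (_∈ₗ L)
  rooting []      = record { root = id ; walk = λ () ; root-resp-adj = λ () }
  rooting (v ∷ L) = Extend.rooting′ (rooting L) v


  module _ (D : Subset n) where

    open Rooting (Rooting-map (λ u∈L → proj₂ (∈-filter⁻ (_∈? D) {xs = allFin n} u∈L))
                              (λ u∈D → ∈-filter⁺ (_∈? D) (∈-allFin _) u∈D)
                              (rooting (filter (_∈? D) (allFin n))))

    colour : Fin n → Parity
    colour u with u ∈? D
    ... | yes u∈D = parity (len (walk u∈D))
    ... | no  _   = 0ℙ

    walk-colour : ∀ {u} → u ∈ D → Σ (Walk (_∈ D) (root u) u) λ w → parity (len w) ≡ colour u
    walk-colour {u} u∈D with u ∈? D
    ... | yes u∈D′ = walk u∈D′ , refl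
    ... | no  u∉D  = contradiction u∈D u∉D

    oddCycle⊎properColouring : OddCycleIn (_∈ D) ⊎ ProperColouring G D colour
    oddCycle⊎properColouring
      with any? (λ u → any? λ u′ →
             (u ∈? D) ×-dec (u′ ∈? D) ×-dec (adj G u u′ ≟ᵇ true) ×-dec (colour u ≟ᵖ colour u′))
    ... | yes (u , u′ , u∈D , u′∈D , u~u′ , same)
      with w , w-colour ← walk-colour u∈D | w′ , w′-colour ← walk-colour u′∈D =
      inj₁ (sameParityEdge⇒oddCycle w w′ (root-resp-adj u∈D u′∈D u~u′) u~u′
                                    (trans w-colour (trans same (sym w′-colour))))
    ... | no ¬bad = inj₂ λ u∈D u′∈D u~u′ same → ¬bad (_ , _ , u∈D , u′∈D , u~u′ , same)

module _ (G : Graph n) where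

  open Walks G
  open Rootings G

  oddCycle⊎largeIndependent : ∀ D → OddCycleIn (_∈ D) ⊎ LargeIndependentSubset G D 0
  oddCycle⊎largeIndependent D =
    Sum.map₂ (properColouring⇒largeIndependent G) (oddCycle⊎properColouring D)

  someEdge : (c : Cycle G) → ∃₂ λ x y → HasEdge c x y
  someEdge c with verts c | long c
  ... | x ∷ y ∷ _ | _      = x , y , inj₁ (here refl)
  ... | _ ∷ []    | s≤s ()

  hasEdge⇒∈verts : ∀ (c : Cycle G) {x y} → HasEdge c x y → x ∈ₗ verts c
  hasEdge⇒∈verts c (inj₁ xy∈c) = proj₁ (∈-cyclicPairs⁻ (verts c) xy∈c)
  hasEdge⇒∈verts c (inj₂ yx∈c) = proj₂ (∈-cyclicPairs⁻ (verts c) yx∈c)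

  sameCycle-visits : ∀ (c d : Cycle G) {P : Fin n → Set} {x y} →
                     SameCycle c d → HasEdge c x y → All P (verts d) → P x
  sameCycle-visits c d {x = x} {y} c≈d xy∈c all =
    All.lookup all (hasEdge⇒∈verts d (Equivalence.to (c≈d x y) xy∈c))

  atMostTwoOddCycles⇒largeIndependent : AtMostTwoOddCycles G → ∀ D → LargeIndependentSubset G D 2
  atMostTwoOddCycles⇒largeIndependent twoOdd D with oddCycle⊎largeIndependent D
  ... | inj₂ large₀ = largeIndependent-weaken G z≤n large₀
  ... | inj₁ (c₁ , odd₁ , c₁⊆D)
    with x₁ , _ , x₁∈c₁ ← someEdge c₁
    with oddCycle⊎largeIndependent (D - x₁)
  ... | inj₂ large₁ = largeIndependent-delete G (largeIndependent-weaken G z≤n large₁)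
  ... | inj₁ (c₂ , odd₂ , c₂⊆D-x₁)
    with x₂ , _ , x₂∈c₂ ← someEdge c₂
    with oddCycle⊎largeIndependent (D - x₁ - x₂)
  ... | inj₂ large₂ = largeIndependent-delete G (largeIndependent-delete G large₂)
  ... | inj₁ (c₃ , odd₃ , c₃⊆D-x₁-x₂) with twoOdd (c₁ , odd₁) (c₂ , odd₂) (c₃ , odd₃)
  ... | inj₁ c₁≈c₂ =
        contradiction (sameCycle-visits c₁ c₂ c₁≈c₂ x₁∈c₁ c₂⊆D-x₁) (x∉p-x D x₁)
  ... | inj₂ (inj₁ c₁≈c₃) =
        contradiction (p─q⊆p (D - x₁) ⁅ x₂ ⁆ (sameCycle-visits c₁ c₃ c₁≈c₃ x₁∈c₁ c₃⊆D-x₁-x₂))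
                      (x∉p-x D x₁)
  ... | inj₂ (inj₂ c₂≈c₃) =
        contradiction (sameCycle-visits c₂ c₃ c₂≈c₃ x₂∈c₂ c₃⊆D-x₁-x₂) (x∉p-x (D - x₁) x₂)

mainTheorem6 : ∀ {n} (G : Graph n) → AtMostTwoOddCycles G →
    ∀ (a : ℕ) (C K : Subset n) → IsAlpha G a → IsCore G C → IsCorona G K →
      (2 * a ≤ ∣ C ∣ + ∣ K ∣) × (∣ C ∣ + ∣ K ∣ ≤ 2 * a + 2)
mainTheorem6 G twoOdd a C K α core corona =
  2α≤∣core∣+∣corona∣ , ∣core∣+∣corona∣≤2α+k (atMostTwoOddCycles⇒largeIndependent G twoOdd (K ─ C))
  where open CoreCorona G α core corona
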